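{- The internal weakening rule $(iw)$: from $\mathcal{G}/\!/\Gamma_1\vdash\Delta_1/\!/\mathcal{H}$ infer $\mathcal{G}/\!/\Gamma_1,\Gamma_2\vdash\Delta_1,\Delta_2/\!/\mathcal{H}$ (for arbitrary finite multisets $\Gamma_2,\Delta_2$), is height-preserving admissible in $\mathsf{LNIF}$: whenever the premise has an $\mathsf{LNIF}$-derivation of height $h$, the conclusion has an $\mathsf{LNIF}$-derivation of height at most $h$.
   Context: The height of a derivation is the number of sequents on its longest branch from the end sequent to an initial sequent. Formulae are first-order over $\bot,\land,\lor,\supset,\forall,\exists$; in sequents bound variables $x,y,\dots$ are distinct from parameters $a,b,\dots$, which occupy all free positions; $A[a/x]$ replaces free occurrences of $x$ by $a$; $p(\vec a)$ is an atomic formula with parameters $\vec a$. A linear nested sequent is $\Gamma_1\vdash\Delta_1 /\!/ \cdots /\!/ \Gamma_n\vdash\Delta_n$ ($n\ge1$), each $\Gamma_i,\Delta_i$ a finite, possibly empty, multiset of formulae (a component). In rule schemas, $\mathcal{G},\mathcal{H},\mathcal{F}$ denote possibly empty sequences of components. $\mathsf{LNIF}$ has the rules (from premise(s) infer conclusion): Initial: $(id_1)$ $\mathcal{G}/\!/\Gamma,p(\vec a)\vdash p(\vec a),\Delta/\!/\mathcal{H}$; $(id_2)$ $\mathcal{G}/\!/\Gamma_1,p(\vec a)\vdash\Delta_1/\!/\mathcal{H}/\!/\Gamma_2\vdash p(\vec a),\Delta_2/\!/\mathcal{F}$; $(\bot_l)$ $\mathcal{G}/\!/\Gamma,\bot\vdash\Delta/\!/\mathcal{H}$.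 $(\land_l)$: from $\mathcal{G}/\!/\Gamma,A,B\vdash\Delta/\!/\mathcal{H}$ infer $\mathcal{G}/\!/\Gamma,A\land B\vdash\Delta/\!/\mathcal{H}$. $(\lor_r)$: from $\mathcal{G}/\!/\Gamma\vdash\Delta,A,B/\!/\mathcal{H}$ infer $\mathcal{G}/\!/\Gamma\vdash\Delta,A\lor B/\!/\mathcal{H}$. $(\land_r)$: from $\mathcal{G}/\!/\Gamma\vdash\Delta,A/\!/\mathcal{H}$ and $\mathcal{G}/\!/\Gamma\vdash\Delta,B/\!/\mathcal{H}$ infer $\mathcal{G}/\!/\Gamma\vdash\Delta,A\land B/\!/\mathcal{H}$. $(\lor_l)$: from $\mathcal{G}/\!/\Gamma,A\vdash\Delta/\!/\mathcal{H}$ and $\mathcal{G}/\!/\Gamma,B\vdash\Delta/\!/\mathcal{H}$ infer $\mathcal{G}/\!/\Gamma,A\lor B\vdash\Delta/\!/\mathcal{H}$. $(\supset_{r1})$: from $\mathcal{G}/\!/\Gamma\vdash\Delta/\!/A\vdash B$ infer $\mathcal{G}/\!/\Gamma\vdash\Delta,A\supset B$. $(\supset_l)$: from $\mathcal{G}/\!/\Gamma,B\vdash\Delta/\!/\mathcal{H}$ and $\mathcal{G}/\!/\Gamma,A\supset B\vdash A,\Delta/\!/\mathcal{H}$ infer $\mathcal{G}/\!/\Gamma,A\supset B\vdash\Delta/\!/\mathcal{H}$. $(lift)$: from $\mathcal{G}/\!/\Gamma_1,A\vdash\Delta_1/\!/\Gamma_2,A\vdash\Delta_2/\!/\mathcal{H}$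 infer $\mathcal{G}/\!/\Gamma_1,A\vdash\Delta_1/\!/\Gamma_2\vdash\Delta_2/\!/\mathcal{H}$. $(\forall_l)$: from $\mathcal{G}/\!/\Gamma,A[a/x],\forall xA\vdash\Delta/\!/\mathcal{H}$ infer $\mathcal{G}/\!/\Gamma,\forall xA\vdash\Delta/\!/\mathcal{H}$ ($a$ any parameter). $(\forall_{r1})$: from $\mathcal{G}/\!/\Gamma\vdash\Delta/\!/\ \vdash A[a/x]$ infer $\mathcal{G}/\!/\Gamma\vdash\Delta,\forall xA$. $(\exists_l)$: from $\mathcal{G}/\!/\Gamma,A[a/x]\vdash\Delta/\!/\mathcal{H}$ infer $\mathcal{G}/\!/\Gamma,\exists xA\vdash\Delta/\!/\mathcal{H}$. $(\exists_r)$: from $\mathcal{G}/\!/\Gamma\vdash A[a/x],\exists xA,\Delta/\!/\mathcal{H}$ infer $\mathcal{G}/\!/\Gamma\vdash\exists xA,\Delta/\!/\mathcal{H}$ ($a$ any parameter). $(\supset_{r2})$: from $\mathcal{G}/\!/\Gamma_1\vdash\Delta_1/\!/A\vdash B/\!/\Gamma_2\vdash\Delta_2/\!/\mathcal{H}$ and $\mathcal{G}/\!/\Gamma_1\vdash\Delta_1/\!/\Gamma_2\vdash\Delta_2,A\supset B/\!/\mathcal{H}$ infer $\mathcal{G}/\!/\Gamma_1\vdash\Delta_1,A\supset B/\!/\Gamma_2\vdash\Delta_2/\!/\mathcal{H}$. $(\forall_{r2})$: from $\mathcal{G}/\!/\Gamma_1\vdash\Delta_1/\!/\ \vdash A[a/x]/\!/\Gamma_2\vdash\Delta_2/\!/\mathcal{H}$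 and $\mathcal{G}/\!/\Gamma_1\vdash\Delta_1/\!/\Gamma_2\vdash\Delta_2,\forall xA/\!/\mathcal{H}$ infer $\mathcal{G}/\!/\Gamma_1\vdash\Delta_1,\forall xA/\!/\Gamma_2\vdash\Delta_2/\!/\mathcal{H}$. In $(\forall_{r1}),(\exists_l),(\forall_{r2})$, $a$ is an eigenvariable (does not occur in the conclusion). -}

module Defs where

open import Data.Nat using (ℕ; suc; _⊔_; _≟_)
open import Data.List using (List; []; _∷_; _++_; map)
open import Data.List.Relation.Unary.Any using (Any)
open import Data.List.Relation.Binary.Permutation.Propositional using (_↭_)
open import Data.List.Relation.Binary.Pointwise using (Pointwise)
open import Data.Product using (_×_)
open import Data.Sum using (_⊎_)
open import Data.Empty using (⊥)
open import Relation.Nullary using (¬_; does)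
open import Relation.Binary.PropositionalEquality using (_≡_)
open import Data.Bool using (if_then_else_)

data Term : Set where
  var : ℕ → Term
  par : ℕ → Term

infixr 6 _∧'_
infixr 5 _∨'_
infixr 4 _⊃_

data Formula : Set where
  atom : ℕ → List Term → Formula
  ⊥'   : Formula
  _∧'_ : Formula → Formula → Formula
  _∨'_ : Formula → Formula → Formula
  _⊃_  : Formula → Formula → Formula
  ∀'   : ℕ → Formula → Formula
  ∃'   : ℕ → Formula → Formula

substT : Term → ℕ → ℕ → Term
substT (var y) a x = if does (x ≟ y) then par a else var y
substT (par b) a x = par b

_[_/_] : Formula → ℕ → ℕ → Formula
atom p ts [ a / x ] = atom p (map (λ t → substT t a x) ts)
⊥'        [ a / x ] = ⊥'
(A ∧' B)  [ a / x ] = (A [ a / x ]) ∧' (B [ a / x ])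
(A ∨' B)  [ a / x ] = (A [ a / x ]) ∨' (B [ a / x ])
(A ⊃ B)   [ a / x ] = (A [ a / x ]) ⊃ (B [ a / x ])
∀' y A    [ a / x ] = if does (x ≟ y) then ∀' y A else ∀' y (A [ a / x ])
∃' y A    [ a / x ] = if does (x ≟ y) then ∃' y A else ∃' y (A [ a / x ])

OccT : ℕ → Term → Set
OccT a (var x) = ⊥
OccT a (par b) = a ≡ b

OccF : ℕ → Formula → Set
OccF a (atom p ts) = Any (OccT a) ts
OccF a ⊥'          = ⊥
OccF a (A ∧' B)    = OccF a A ⊎ OccF a B
OccF a (A ∨' B)    = OccF a A ⊎ OccF a B
OccF a (A ⊃ B)     = OccF a A ⊎ OccF a B
OccF a (∀' x A)    = OccF a A
OccF a (∃' x A)    = OccF a A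

-- Components Γ ⊢ Δ (multisets represented as lists, compared up to
-- permutation) and linear nested sequents (lists of components).

infix 3 _⊢_
record Comp : Set where
  constructor _⊢_
  field
    ante : List Formula
    succ : List Formula
open Comp public

LNS : Set
LNS = List Comp

_≈C_ : Comp → Comp → Set
c ≈C d = (ante c ↭ ante d) × (succ c ↭ succ d)

_≈S_ : LNS → LNS → Set
_≈S_ = Pointwise _≈C_

OccS : ℕ → LNS → Set
OccS a S = Any (λ c → Any (OccF a) (ante c) ⊎ Any (OccF a) (succ c)) S

-- LNIF derivations. Each rule concludes any sequent S that equals the
-- rule's conclusion schema up to multiset equality of components
-- (Γ,A is written A ∷ Γ).

data Deriv : LNS → Set where
  id₁ : ∀ {S} G Γ p ts Δ H →
        S ≈S (G ++ (atom p ts ∷ Γ ⊢ atom p ts ∷ Δ) ∷ H) → Deriv S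
  id₂ : ∀ {S} G Γ₁ Δ₁ p ts H Γ₂ Δ₂ F →
        S ≈S (G ++ (atom p ts ∷ Γ₁ ⊢ Δ₁) ∷ H ++ (Γ₂ ⊢ atom p ts ∷ Δ₂) ∷ F) → Deriv S
  ⊥l  : ∀ {S} G Γ Δ H →
        S ≈S (G ++ (⊥' ∷ Γ ⊢ Δ) ∷ H) → Deriv S
  ∧l  : ∀ {S} G Γ Δ H A B →
        Deriv (G ++ (A ∷ B ∷ Γ ⊢ Δ) ∷ H) →
        S ≈S (G ++ ((A ∧' B) ∷ Γ ⊢ Δ) ∷ H) → Deriv S
  ∨r  : ∀ {S} G Γ Δ H A B →
        Deriv (G ++ (Γ ⊢ A ∷ B ∷ Δ) ∷ H) →
        S ≈S (G ++ (Γ ⊢ (A ∨' B) ∷ Δ) ∷ H) → Deriv S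
  ∧r  : ∀ {S} G Γ Δ H A B →
        Deriv (G ++ (Γ ⊢ A ∷ Δ) ∷ H) →
        Deriv (G ++ (Γ ⊢ B ∷ Δ) ∷ H) →
        S ≈S (G ++ (Γ ⊢ (A ∧' B) ∷ Δ) ∷ H) → Deriv S
  ∨l  : ∀ {S} G Γ Δ H A B →
        Deriv (G ++ (A ∷ Γ ⊢ Δ) ∷ H) →
        Deriv (G ++ (B ∷ Γ ⊢ Δ) ∷ H) →
        S ≈S (G ++ ((A ∨' B) ∷ Γ ⊢ Δ) ∷ H) → Deriv S
  ⊃r₁ : ∀ {S} G Γ Δ A B →
        Deriv (G ++ (Γ ⊢ Δ) ∷ (A ∷ [] ⊢ B ∷ []) ∷ []) →
        S ≈S (G ++ (Γ ⊢ (A ⊃ B) ∷ Δ) ∷ []) → Deriv S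
  ⊃l  : ∀ {S} G Γ Δ H A B →
        Deriv (G ++ (B ∷ Γ ⊢ Δ) ∷ H) →
        Deriv (G ++ ((A ⊃ B) ∷ Γ ⊢ A ∷ Δ) ∷ H) →
        S ≈S (G ++ ((A ⊃ B) ∷ Γ ⊢ Δ) ∷ H) → Deriv S
  lift : ∀ {S} G Γ₁ Δ₁ Γ₂ Δ₂ H A →
        Deriv (G ++ (A ∷ Γ₁ ⊢ Δ₁) ∷ (A ∷ Γ₂ ⊢ Δ₂) ∷ H) →
        S ≈S (G ++ (A ∷ Γ₁ ⊢ Δ₁) ∷ (Γ₂ ⊢ Δ₂) ∷ H) → Deriv S
  ∀l  : ∀ {S} G Γ Δ H x A a →
        Deriv (G ++ ((A [ a / x ]) ∷ ∀' x A ∷ Γ ⊢ Δ) ∷ H) →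
        S ≈S (G ++ (∀' x A ∷ Γ ⊢ Δ) ∷ H) → Deriv S
  ∀r₁ : ∀ {S} G Γ Δ x A a →
        ¬ OccS a S →
        Deriv (G ++ (Γ ⊢ Δ) ∷ ([] ⊢ (A [ a / x ]) ∷ []) ∷ []) →
        S ≈S (G ++ (Γ ⊢ ∀' x A ∷ Δ) ∷ []) → Deriv S
  ∃l  : ∀ {S} G Γ Δ H x A a →
        ¬ OccS a S →
        Deriv (G ++ ((A [ a / x ]) ∷ Γ ⊢ Δ) ∷ H) →
        S ≈S (G ++ (∃' x A ∷ Γ ⊢ Δ) ∷ H) → Deriv S
  ∃r  : ∀ {S} G Γ Δ H x A a →
        Deriv (G ++ (Γ ⊢ (A [ a / x ]) ∷ ∃' x A ∷ Δ) ∷ H) →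
        S ≈S (G ++ (Γ ⊢ ∃' x A ∷ Δ) ∷ H) → Deriv S
  ⊃r₂ : ∀ {S} G Γ₁ Δ₁ Γ₂ Δ₂ H A B →
        Deriv (G ++ (Γ₁ ⊢ Δ₁) ∷ (A ∷ [] ⊢ B ∷ []) ∷ (Γ₂ ⊢ Δ₂) ∷ H) →
        Deriv (G ++ (Γ₁ ⊢ Δ₁) ∷ (Γ₂ ⊢ (A ⊃ B) ∷ Δ₂) ∷ H) →
        S ≈S (G ++ (Γ₁ ⊢ (A ⊃ B) ∷ Δ₁) ∷ (Γ₂ ⊢ Δ₂) ∷ H) → Deriv S
  ∀r₂ : ∀ {S} G Γ₁ Δ₁ Γ₂ Δ₂ H x A a →
        ¬ OccS a S →
        Deriv (G ++ (Γ₁ ⊢ Δ₁) ∷ ([] ⊢ (A [ a / x ]) ∷ []) ∷ (Γ₂ ⊢ Δ₂) ∷ H) →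
        Deriv (G ++ (Γ₁ ⊢ Δ₁) ∷ (Γ₂ ⊢ ∀' x A ∷ Δ₂) ∷ H) →
        S ≈S (G ++ (Γ₁ ⊢ ∀' x A ∷ Δ₁) ∷ (Γ₂ ⊢ Δ₂) ∷ H) → Deriv S

height : ∀ {S} → Deriv S → ℕ
height (id₁ _ _ _ _ _ _ _) = 1
height (id₂ _ _ _ _ _ _ _ _ _ _) = 1
height (⊥l _ _ _ _ _) = 1
height (∧l _ _ _ _ _ _ d _) = suc (height d)
height (∨r _ _ _ _ _ _ d _) = suc (height d)
height (∧r _ _ _ _ _ _ d e _) = suc (height d ⊔ height e)
height (∨l _ _ _ _ _ _ d e _) = suc (height d ⊔ height e)
height (⊃r₁ _ _ _ _ _ d _) = suc (height d)
height (⊃l _ _ _ _ _ _ d e _) = suc (height d ⊔ height e)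
height (lift _ _ _ _ _ _ _ d _) = suc (height d)
height (∀l _ _ _ _ _ _ _ d _) = suc (height d)
height (∀r₁ _ _ _ _ _ _ _ d _) = suc (height d)
height (∃l _ _ _ _ _ _ _ _ d _) = suc (height d)
height (∃r _ _ _ _ _ _ _ d _) = suc (height d)
height (⊃r₂ _ _ _ _ _ _ _ _ d e _) = suc (height d ⊔ height e)
height (∀r₂ _ _ _ _ _ _ _ _ _ _ d e _) = suc (height d ⊔ height e)

-- Weakening is proved simultaneously with renaming of parameters: for every map f on
-- parameters, a derivation of S yields a derivation, of no greater height, of any sequent
-- that weakens the f-image of S componentwise.  Every rule commutes with both operations,
-- except that the eigenvariable a of (∀r₁), (∃l), (∀r₂) may occur in the added formulas.
-- There the induction continues with f updated to send a to a parameter fresh for the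
-- target sequent; this changes nothing on the conclusion, in which a does not occur.

module Submission where

open import Defs
open import Data.Nat using (ℕ; suc; _≤_; _⊔_; _≟_; _≡ᵇ_; s≤s)
open import Data.Bool using (true; false)
open import Data.Nat.Properties using (⊔-mono-≤; ≤-refl; m≤n⇒m≤n⊔o; m≤n⇒m≤o⊔n; 1+n≰n)
open import Data.List using (List; []; _∷_; _++_; map; foldr)
open import Data.List.Properties using (map-id; map-cong; map-∘; ++-identityʳ)
open import Data.List.Relation.Unary.Any using (Any; here; there)
open import Data.List.Relation.Binary.Permutation.Propositional using (_↭_; ↭-refl; ↭-trans; ↭-reflexive)
import Data.List.Relation.Binary.Permutation.Propositional.Properties as ↭
open import Data.List.Relation.Binary.Pointwise as Pointwise using (Pointwise; []; _∷_; ++⁺)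
open import Data.Product using (Σ; Σ-syntax; _×_; _,_)
open import Data.Sum using (_⊎_; inj₁; inj₂)
open import Function using (id; _∘_)
open import Data.Empty using (⊥-elim)
open import Relation.Nullary using (¬_; yes; no)
open import Relation.Binary.PropositionalEquality using (_≡_; refl; sym; trans; cong; cong₂; subst; module ≡-Reasoning)

renameT : (ℕ → ℕ) → Term → Term
renameT f (var x) = var x
renameT f (par b) = par (f b)

renameF : (ℕ → ℕ) → Formula → Formula
renameF f (atom p ts) = atom p (map (renameT f) ts)
renameF f ⊥'          = ⊥'
renameF f (A ∧' B)    = renameF f A ∧' renameF f B
renameF f (A ∨' B)    = renameF f A ∨' renameF f B
renameF f (A ⊃ B)     = renameF f A ⊃ renameF f B
renameF f (∀' x A)    = ∀' x (renameF f A)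
renameF f (∃' x A)    = ∃' x (renameF f A)

renameL : (ℕ → ℕ) → List Formula → List Formula
renameL f = map (renameF f)

renameC : (ℕ → ℕ) → Comp → Comp
renameC f (Γ ⊢ Δ) = renameL f Γ ⊢ renameL f Δ

renameT-id : ∀ t → renameT id t ≡ t
renameT-id (var x) = refl
renameT-id (par b) = refl

renameF-id : ∀ A → renameF id A ≡ A
renameF-id (atom p ts) = cong (atom p) (trans (map-cong renameT-id ts) (map-id ts))
renameF-id ⊥'          = refl
renameF-id (A ∧' B)    = cong₂ _∧'_ (renameF-id A) (renameF-id B)
renameF-id (A ∨' B)    = cong₂ _∨'_ (renameF-id A) (renameF-id B)
renameF-id (A ⊃ B)     = cong₂ _⊃_ (renameF-id A) (renameF-id B)
renameF-id (∀' x A)    = cong (∀' x) (renameF-id A)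
renameF-id (∃' x A)    = cong (∃' x) (renameF-id A)

renameC-id : ∀ k → renameC id k ≡ k
renameC-id (Γ ⊢ Δ) = cong₂ _⊢_ (renameL-id Γ) (renameL-id Δ)
  where
  renameL-id : ∀ Γ → renameL id Γ ≡ Γ
  renameL-id Γ = trans (map-cong renameF-id Γ) (map-id Γ)

renameT-substT : ∀ f a x t → renameT f (substT t a x) ≡ substT (renameT f t) (f a) x
renameT-substT f a x (var y) with x ≡ᵇ y
... | true  = refl
... | false = refl
renameT-substT f a x (par b) = refl

renameF-subst : ∀ f a x A → renameF f (A [ a / x ]) ≡ renameF f A [ f a / x ]
renameF-subst f a x (atom p ts) = cong (atom p) (begin
  map (renameT f) (map (λ t → substT t a x) ts)        ≡⟨ map-∘ ts ⟨
  map (λ t → renameT f (substT t a x)) ts              ≡⟨ map-cong (renameT-substT f a x) ts ⟩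
  map (λ t → substT (renameT f t) (f a) x) ts          ≡⟨ map-∘ ts ⟩
  map (λ t → substT t (f a) x) (map (renameT f) ts)    ∎)
  where open ≡-Reasoning
renameF-subst f a x ⊥'       = refl
renameF-subst f a x (A ∧' B) = cong₂ _∧'_ (renameF-subst f a x A) (renameF-subst f a x B)
renameF-subst f a x (A ∨' B) = cong₂ _∨'_ (renameF-subst f a x A) (renameF-subst f a x B)
renameF-subst f a x (A ⊃ B)  = cong₂ _⊃_ (renameF-subst f a x A) (renameF-subst f a x B)
renameF-subst f a x (∀' y A) with x ≡ᵇ y
... | true  = refl
... | false = cong (∀' y) (renameF-subst f a x A)
renameF-subst f a x (∃' y A) with x ≡ᵇ y
... | true  = refl
... | false = cong (∃' y) (renameF-subst f a x A)

renameT-cong : ∀ {f g} t → (∀ {b} → OccT b t → f b ≡ g b) → renameT f t ≡ renameT g t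
renameT-cong (var x) _  = refl
renameT-cong (par b) eq = cong par (eq refl)

renameF-cong : ∀ {f g} A → (∀ {b} → OccF b A → f b ≡ g b) → renameF f A ≡ renameF g A
renameF-cong {f} {g} (atom p ts) eq = cong (atom p) (map-renameT-cong ts eq)
  where
  map-renameT-cong : ∀ ts → (∀ {b} → Any (OccT b) ts → f b ≡ g b) →
                     map (renameT f) ts ≡ map (renameT g) ts
  map-renameT-cong []       _  = refl
  map-renameT-cong (t ∷ ts) eq =
    cong₂ _∷_ (renameT-cong t (eq ∘ here)) (map-renameT-cong ts (eq ∘ there))
renameF-cong ⊥'       _  = refl
renameF-cong (A ∧' B) eq = cong₂ _∧'_ (renameF-cong A (eq ∘ inj₁)) (renameF-cong B (eq ∘ inj₂))
renameF-cong (A ∨' B) eq = cong₂ _∨'_ (renameF-cong A (eq ∘ inj₁)) (renameF-cong B (eq ∘ inj₂))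
renameF-cong (A ⊃ B)  eq = cong₂ _⊃_ (renameF-cong A (eq ∘ inj₁)) (renameF-cong B (eq ∘ inj₂))
renameF-cong (∀' x A) eq = cong (∀' x) (renameF-cong A eq)
renameF-cong (∃' x A) eq = cong (∃' x) (renameF-cong A eq)

renameL-cong : ∀ {f g} Γ → (∀ {b} → Any (OccF b) Γ → f b ≡ g b) → renameL f Γ ≡ renameL g Γ
renameL-cong []      _  = refl
renameL-cong (A ∷ Γ) eq = cong₂ _∷_ (renameF-cong A (eq ∘ here)) (renameL-cong Γ (eq ∘ there))

renameC-cong : ∀ {f g} k → (∀ {b} → Any (OccF b) (ante k) ⊎ Any (OccF b) (succ k) → f b ≡ g b) →
               renameC f k ≡ renameC g k
renameC-cong (Γ ⊢ Δ) eq = cong₂ _⊢_ (renameL-cong Γ (eq ∘ inj₁)) (renameL-cong Δ (eq ∘ inj₂))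

_[_↦_] : (ℕ → ℕ) → ℕ → ℕ → ℕ → ℕ
(f [ a ↦ c ]) b with b ≟ a
... | yes _ = c
... | no _  = f b

update-≡ : ∀ f a c → (f [ a ↦ c ]) a ≡ c
update-≡ f a c with a ≟ a
... | yes _   = refl
... | no a≢a  = ⊥-elim (a≢a refl)

update-≢ : ∀ f {a b} c → ¬ b ≡ a → f b ≡ (f [ a ↦ c ]) b
update-≢ f {a} {b} c b≢a with b ≟ a
... | yes b≡a = ⊥-elim (b≢a b≡a)
... | no _    = refl

⨆ : {A : Set} → (A → ℕ) → List A → ℕ
⨆ g = foldr (λ x m → g x ⊔ m) 0

Any⇒≤⨆ : ∀ {A : Set} {P : A → Set} {g a} xs → (∀ x → P x → a ≤ g x) → Any P xs → a ≤ ⨆ g xs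
Any⇒≤⨆ {g = g} (x ∷ xs) le (here px)  = m≤n⇒m≤n⊔o (⨆ g xs) (le x px)
Any⇒≤⨆ {g = g} (x ∷ xs) le (there p)  = m≤n⇒m≤o⊔n (g x) (Any⇒≤⨆ xs le p)

supT : Term → ℕ
supT (var _) = 0
supT (par b) = b

supF : Formula → ℕ
supF (atom p ts) = ⨆ supT ts
supF ⊥'          = 0
supF (A ∧' B)    = supF A ⊔ supF B
supF (A ∨' B)    = supF A ⊔ supF B
supF (A ⊃ B)     = supF A ⊔ supF B
supF (∀' x A)    = supF A
supF (∃' x A)    = supF A

supS : LNS → ℕ
supS = ⨆ λ k → ⨆ supF (ante k) ⊔ ⨆ supF (succ k)

OccT⇒≤supT : ∀ {a} t → OccT a t → a ≤ supT t
OccT⇒≤supT (par b) refl = ≤-refl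

OccF⇒≤supF : ∀ {a} A → OccF a A → a ≤ supF A
OccF⇒≤supF (atom p ts) o        = Any⇒≤⨆ ts OccT⇒≤supT o
OccF⇒≤supF (A ∧' B)    (inj₁ o) = m≤n⇒m≤n⊔o (supF B) (OccF⇒≤supF A o)
OccF⇒≤supF (A ∧' B)    (inj₂ o) = m≤n⇒m≤o⊔n (supF A) (OccF⇒≤supF B o)
OccF⇒≤supF (A ∨' B)    (inj₁ o) = m≤n⇒m≤n⊔o (supF B) (OccF⇒≤supF A o)
OccF⇒≤supF (A ∨' B)    (inj₂ o) = m≤n⇒m≤o⊔n (supF A) (OccF⇒≤supF B o)
OccF⇒≤supF (A ⊃ B)     (inj₁ o) = m≤n⇒m≤n⊔o (supF B) (OccF⇒≤supF A o)
OccF⇒≤supF (A ⊃ B)     (inj₂ o) = m≤n⇒m≤o⊔n (supF A) (OccF⇒≤supF B o)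
OccF⇒≤supF (∀' x A)    o        = OccF⇒≤supF A o
OccF⇒≤supF (∃' x A)    o        = OccF⇒≤supF A o

OccS⇒≤supS : ∀ {a} S → OccS a S → a ≤ supS S
OccS⇒≤supS S = Any⇒≤⨆ S λ where
  (Γ ⊢ Δ) (inj₁ o) → m≤n⇒m≤n⊔o (⨆ supF Δ) (Any⇒≤⨆ Γ OccF⇒≤supF o)
  (Γ ⊢ Δ) (inj₂ o) → m≤n⇒m≤o⊔n (⨆ supF Γ) (Any⇒≤⨆ Δ OccF⇒≤supF o)

fresh : LNS → ℕ
fresh S = suc (supS S)

fresh-∉ : ∀ S → ¬ OccS (fresh S) S
fresh-∉ S o = 1+n≰n (OccS⇒≤supS S o)

≈C-refl : ∀ {k} → k ≈C k
≈C-refl = ↭-refl , ↭-refl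

≈C-trans : ∀ {k l m} → k ≈C l → l ≈C m → k ≈C m
≈C-trans (p , q) (p′ , q′) = ↭-trans p p′ , ↭-trans q q′

≈S-refl : ∀ {S} → S ≈S S
≈S-refl = Pointwise.refl ≈C-refl

infix 4 _⊑ᶜ_ _⊑[_]_

_⊑ᶜ_ : Comp → Comp → Set
k ⊑ᶜ k′ = Σ[ X ∈ List Formula ] Σ[ Y ∈ List Formula ] (ante k′ ↭ ante k ++ X) × (succ k′ ↭ succ k ++ Y)

_⊑[_]_ : LNS → (ℕ → ℕ) → LNS → Set
S ⊑[ f ] S′ = Pointwise (λ k k′ → renameC f k ⊑ᶜ k′) S S′

⊑ᶜ-reflexive : ∀ {k k′} → k ≡ k′ → k ⊑ᶜ k′
⊑ᶜ-reflexive refl = [] , [] , ↭-reflexive (sym (++-identityʳ _)) , ↭-reflexive (sym (++-identityʳ _))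

weaken : Comp → List Formula → List Formula → Comp
weaken k X Y = ante k ++ X ⊢ succ k ++ Y

extend : ∀ {k} X Y → k ⊑ᶜ weaken k X Y
extend X Y = X , Y , ↭-refl , ↭-refl

extendˡ : ∀ {B B′ Γ Δ} → B ≡ B′ → ∀ X Y → (B ∷ Γ ⊢ Δ) ⊑ᶜ (B′ ∷ Γ ++ X ⊢ Δ ++ Y)
extendˡ refl = extend

extendʳ : ∀ {B B′ Γ Δ} → B ≡ B′ → ∀ X Y → (Γ ⊢ B ∷ Δ) ⊑ᶜ (Γ ++ X ⊢ B′ ∷ Δ ++ Y)
extendʳ refl = extend

⊑-id : ∀ S → S ⊑[ id ] S
⊑-id []      = []
⊑-id (k ∷ S) = ⊑ᶜ-reflexive (renameC-id k) ∷ ⊑-id S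

⊑-resp-≈ : ∀ {f S T S′} → S ≈S T → S ⊑[ f ] S′ → T ⊑[ f ] S′
⊑-resp-≈     []             []                       = []
⊑-resp-≈ {f} ((p , q) ∷ eqs) ((X , Y , p′ , q′) ∷ ws) =
  (X , Y , ↭-trans p′ (↭.++⁺ʳ X (↭.map⁺ (renameF f) p))
         , ↭-trans q′ (↭.++⁺ʳ Y (↭.map⁺ (renameF f) q)))
  ∷ ⊑-resp-≈ eqs ws

⊑-update : ∀ {f a S S′} c → ¬ OccS a S → S ⊑[ f ] S′ → S ⊑[ f [ a ↦ c ] ] S′
⊑-update c a∉S []                 = []
⊑-update {f} {a} {k ∷ _} c a∉S (w ∷ ws) =
  subst (_⊑ᶜ _) (renameC-cong k λ o → update-≢ f {a} c (λ { refl → a∉S (here o) })) w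
  ∷ ⊑-update c (a∉S ∘ there) ws

renameF-subst-update : ∀ f a c x A →
                       renameF (f [ a ↦ c ]) (A [ a / x ]) ≡ renameF (f [ a ↦ c ]) A [ c / x ]
renameF-subst-update f a c x A =
  trans (renameF-subst (f [ a ↦ c ]) a x A) (cong (renameF (f [ a ↦ c ]) A [_/ x ]) (update-≡ f a c))

data Focus (f : ℕ → ℕ) (G : LNS) (k : Comp) (H : LNS) : LNS → Set where
  focused : ∀ {S′} G′ H′ X Y → S′ ≈S (G′ ++ weaken (renameC f k) X Y ∷ H′) →
            G ⊑[ f ] G′ → H ⊑[ f ] H′ → Focus f G k H S′

focus : ∀ {f} G {k H S′} → (G ++ k ∷ H) ⊑[ f ] S′ → Focus f G k H S′
focus []      ((X , Y , p , q) ∷ ws) = focused [] _ X Y ((p , q) ∷ ≈S-refl) [] ws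
focus (_ ∷ G) (w ∷ ws) with focus G ws
... | focused G′ H′ X Y eqv ⊑G ⊑H = focused (_ ∷ G′) H′ X Y (≈C-refl ∷ eqv) (w ∷ ⊑G) ⊑H

data Focus₂ (f : ℕ → ℕ) (G : LNS) (k : Comp) (M : LNS) (l : Comp) (H : LNS) : LNS → Set where
  focused₂ : ∀ {S′} G′ M′ H′ X Y X′ Y′ →
             S′ ≈S (G′ ++ weaken (renameC f k) X Y ∷
                    M′ ++ weaken (renameC f l) X′ Y′ ∷ H′) →
             G ⊑[ f ] G′ → M ⊑[ f ] M′ → H ⊑[ f ] H′ → Focus₂ f G k M l H S′

focus₂ : ∀ {f} G {k} M {l H S′} → (G ++ k ∷ M ++ l ∷ H) ⊑[ f ] S′ → Focus₂ f G k M l H S′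
focus₂ G M ws with focus G ws
... | focused G′ R′ X Y eqv ⊑G ⊑R with focus M ⊑R
... | focused M′ H′ X′ Y′ eqv′ ⊑M ⊑H =
  focused₂ G′ M′ H′ X Y X′ Y′ (Pointwise.transitive ≈C-trans eqv (++⁺ ≈S-refl (≈C-refl ∷ eqv′)))
           ⊑G ⊑M ⊑H

rename-weaken : ∀ (f : ℕ → ℕ) {S S′} (d : Deriv S) → S ⊑[ f ] S′ →
                Σ[ d′ ∈ Deriv S′ ] height d′ ≤ height d
rename-weaken f (id₁ G Γ p ts Δ H e) w with focus G (⊑-resp-≈ e w)
... | focused G′ H′ _ _ eqv _ _ = id₁ G′ _ p _ _ H′ eqv , ≤-refl
rename-weaken f (id₂ G Γ₁ Δ₁ p ts H Γ₂ Δ₂ F e) w with focus₂ G H (⊑-resp-≈ e w)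
... | focused₂ G′ H′ F′ _ _ _ _ eqv _ _ _ = id₂ G′ _ _ p _ H′ _ _ F′ eqv , ≤-refl
rename-weaken f (⊥l G Γ Δ H e) w with focus G (⊑-resp-≈ e w)
... | focused G′ H′ _ _ eqv _ _ = ⊥l G′ _ _ H′ eqv , ≤-refl
rename-weaken f (∧l G Γ Δ H A B d e) w with focus G (⊑-resp-≈ e w)
... | focused G′ H′ X Y eqv ⊑G ⊑H with rename-weaken f d (++⁺ ⊑G (extend X Y ∷ ⊑H))
... | d′ , h = ∧l G′ _ _ H′ _ _ d′ eqv , s≤s h
rename-weaken f (∨r G Γ Δ H A B d e) w with focus G (⊑-resp-≈ e w)
... | focused G′ H′ X Y eqv ⊑G ⊑H with rename-weaken f d (++⁺ ⊑G (extend X Y ∷ ⊑H))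
... | d′ , h = ∨r G′ _ _ H′ _ _ d′ eqv , s≤s h
rename-weaken f (∧r G Γ Δ H A B d₁ d₂ e) w with focus G (⊑-resp-≈ e w)
... | focused G′ H′ X Y eqv ⊑G ⊑H
  with rename-weaken f d₁ (++⁺ ⊑G (extend X Y ∷ ⊑H))
     | rename-weaken f d₂ (++⁺ ⊑G (extend X Y ∷ ⊑H))
... | d₁′ , h₁ | d₂′ , h₂ = ∧r G′ _ _ H′ _ _ d₁′ d₂′ eqv , s≤s (⊔-mono-≤ h₁ h₂)
rename-weaken f (∨l G Γ Δ H A B d₁ d₂ e) w with focus G (⊑-resp-≈ e w)
... | focused G′ H′ X Y eqv ⊑G ⊑H
  with rename-weaken f d₁ (++⁺ ⊑G (extend X Y ∷ ⊑H))
     | rename-weaken f d₂ (++⁺ ⊑G (extend X Y ∷ ⊑H))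
... | d₁′ , h₁ | d₂′ , h₂ = ∨l G′ _ _ H′ _ _ d₁′ d₂′ eqv , s≤s (⊔-mono-≤ h₁ h₂)
rename-weaken f (⊃r₁ G Γ Δ A B d e) w with focus G (⊑-resp-≈ e w)
... | focused G′ [] X Y eqv ⊑G [] with rename-weaken f d (++⁺ ⊑G (extend X Y ∷ extend [] [] ∷ []))
... | d′ , h = ⊃r₁ G′ _ _ _ _ d′ eqv , s≤s h
rename-weaken f (⊃l G Γ Δ H A B d₁ d₂ e) w with focus G (⊑-resp-≈ e w)
... | focused G′ H′ X Y eqv ⊑G ⊑H
  with rename-weaken f d₁ (++⁺ ⊑G (extend X Y ∷ ⊑H))
     | rename-weaken f d₂ (++⁺ ⊑G (extend X Y ∷ ⊑H))
... | d₁′ , h₁ | d₂′ , h₂ = ⊃l G′ _ _ H′ _ _ d₁′ d₂′ eqv , s≤s (⊔-mono-≤ h₁ h₂)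
rename-weaken f (lift G Γ₁ Δ₁ Γ₂ Δ₂ H A d e) w with focus₂ G [] (⊑-resp-≈ e w)
... | focused₂ G′ [] H′ X Y X′ Y′ eqv ⊑G [] ⊑H
  with rename-weaken f d (++⁺ ⊑G (extend X Y ∷ extend X′ Y′ ∷ ⊑H))
... | d′ , h = lift G′ _ _ _ _ H′ _ d′ eqv , s≤s h
rename-weaken f (∀l G Γ Δ H x A a d e) w with focus G (⊑-resp-≈ e w)
... | focused G′ H′ X Y eqv ⊑G ⊑H
  with rename-weaken f d (++⁺ ⊑G (extendˡ (renameF-subst f a x A) X Y ∷ ⊑H))
... | d′ , h = ∀l G′ _ _ H′ x _ (f a) d′ eqv , s≤s h
rename-weaken f (∃r G Γ Δ H x A a d e) w with focus G (⊑-resp-≈ e w)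
... | focused G′ H′ X Y eqv ⊑G ⊑H
  with rename-weaken f d (++⁺ ⊑G (extendʳ (renameF-subst f a x A) X Y ∷ ⊑H))
... | d′ , h = ∃r G′ _ _ H′ x _ (f a) d′ eqv , s≤s h
rename-weaken f (⊃r₂ G Γ₁ Δ₁ Γ₂ Δ₂ H A B d₁ d₂ e) w with focus₂ G [] (⊑-resp-≈ e w)
... | focused₂ G′ [] H′ X Y X′ Y′ eqv ⊑G [] ⊑H
  with rename-weaken f d₁ (++⁺ ⊑G (extend X Y ∷ extend [] [] ∷ extend X′ Y′ ∷ ⊑H))
     | rename-weaken f d₂ (++⁺ ⊑G (extend X Y ∷ extend X′ Y′ ∷ ⊑H))
... | d₁′ , h₁ | d₂′ , h₂ = ⊃r₂ G′ _ _ _ _ H′ _ _ d₁′ d₂′ eqv , s≤s (⊔-mono-≤ h₁ h₂)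
rename-weaken f {S′ = S′} (∃l G Γ Δ H x A a a∉S d e) w
  with focus G (⊑-resp-≈ e (⊑-update (fresh S′) a∉S w))
... | focused G′ H′ X Y eqv ⊑G ⊑H
  with rename-weaken (f [ a ↦ fresh S′ ]) d
         (++⁺ ⊑G (extendˡ (renameF-subst-update f a (fresh S′) x A) X Y ∷ ⊑H))
... | d′ , h = ∃l G′ _ _ H′ x _ (fresh S′) (fresh-∉ S′) d′ eqv , s≤s h
rename-weaken f {S′ = S′} (∀r₁ G Γ Δ x A a a∉S d e) w
  with focus G (⊑-resp-≈ e (⊑-update (fresh S′) a∉S w))
... | focused G′ [] X Y eqv ⊑G []
  with rename-weaken (f [ a ↦ fresh S′ ]) d
         (++⁺ ⊑G (extend X Y ∷ extendʳ (renameF-subst-update f a (fresh S′) x A) [] [] ∷ []))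
... | d′ , h = ∀r₁ G′ _ _ x _ (fresh S′) (fresh-∉ S′) d′ eqv , s≤s h
rename-weaken f {S′ = S′} (∀r₂ G Γ₁ Δ₁ Γ₂ Δ₂ H x A a a∉S d₁ d₂ e) w
  with focus₂ G [] (⊑-resp-≈ e (⊑-update (fresh S′) a∉S w))
... | focused₂ G′ [] H′ X Y X′ Y′ eqv ⊑G [] ⊑H
  with rename-weaken (f [ a ↦ fresh S′ ]) d₁
         (++⁺ ⊑G (extend X Y ∷ extendʳ (renameF-subst-update f a (fresh S′) x A) [] []
                  ∷ extend X′ Y′ ∷ ⊑H))
     | rename-weaken (f [ a ↦ fresh S′ ]) d₂ (++⁺ ⊑G (extend X Y ∷ extend X′ Y′ ∷ ⊑H))
... | d₁′ , h₁ | d₂′ , h₂ =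
  ∀r₂ G′ _ _ _ _ H′ x _ (fresh S′) (fresh-∉ S′) d₁′ d₂′ eqv , s≤s (⊔-mono-≤ h₁ h₂)

lemma5 : (G : LNS) (Γ₁ Δ₁ : List Formula) (H : LNS) (Γ₂ Δ₂ : List Formula) →
    (d : Deriv (G ++ (Γ₁ ⊢ Δ₁) ∷ H)) →
    Σ (Deriv (G ++ (Γ₁ ++ Γ₂ ⊢ Δ₁ ++ Δ₂) ∷ H)) (λ d′ → height d′ ≤ height d)
lemma5 G Γ₁ Δ₁ H Γ₂ Δ₂ d = rename-weaken id d (++⁺ (⊑-id G) (weaken-focus ∷ ⊑-id H))
  where
  weaken-focus : renameC id (Γ₁ ⊢ Δ₁) ⊑ᶜ (Γ₁ ++ Γ₂ ⊢ Δ₁ ++ Δ₂)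
  weaken-focus = subst (_⊑ᶜ (Γ₁ ++ Γ₂ ⊢ Δ₁ ++ Δ₂)) (sym (renameC-id (Γ₁ ⊢ Δ₁))) (extend Γ₂ Δ₂)
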